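{- Let $\Gamma$ be a multiset of $D$-formulas and let $G$ be a $G$-formula. Then the sequent $\Gamma \longrightarrow G$ has a C-proof (a classical sequent calculus proof) if and only if it has an $\mathbf{I}_G$-proof.
   Context: We work in first-order logic with primitive logical symbols $\top,\bot,\land,\lor,\supset,\exists,\forall$ ($\neg A$ abbreviates $A\supset\bot$). A sequent $\Gamma\longrightarrow\Delta$ is a pair of multisets of formulas; it is an axiom if $\top\in\Delta$, or if some formula $A$ that is $\bot$ or atomic lies in both $\Gamma$ and $\Delta$. The sequent rules are: contraction on the left and on the right; $\bot$-R (from $\Gamma\longrightarrow\Delta,\bot$ infer $\Gamma\longrightarrow\Delta,D$); $\land$-L (from $B,D,B\land D,\Gamma\longrightarrow\Delta$ infer $B\land D,\Gamma\longrightarrow\Delta$); $\land$-R; $\lor$-L (from $B,\Gamma\longrightarrow\Delta$ and $D,\Gamma\longrightarrow\Delta$ infer $B\lor D,\Gamma\longrightarrow\Delta$); the two $\lor$-R rules; $\supset$-L (from $B\supset D,\Gamma\longrightarrow B,\Delta$ and $D,\Gamma\longrightarrow\Theta$ infer $B\supset D,\Gamma\longrightarrow\Delta,\Theta$); $\supset$-R (from $B,\Gamma\longrightarrow\Delta,D$ infer $\Gamma\longrightarrow\Delta,B\supset D$); $\forall$-L (from $[t/x]B,\forall x B,\Gamma\longrightarrow\Delta$ infer $\forall x B,\Gamma\longrightarrow\Delta$); $\exists$-R (from $\Gamma\longrightarrow\Delta,[t/x]B$ infer $\Gamma\longrightarrow\Delta,\exists x B$); $\exists$-L and $\forall$-R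 with a constant $c$ replacing $x$, under the proviso that $c$ does not occur in the lower sequent. A C-proof is a derivation using these rules arbitrarily; an I-proof is a C-proof in which every sequent has exactly one formula in its succedent. $G$-formulas and $D$-formulas are given by the grammar (with $A$ atomic) $G ::= \top \mid \bot \mid A \mid G\land G \mid G\lor G \mid D\supset G \mid \exists x\, G$, $D ::= \top \mid \bot \mid A \mid G\supset D \mid D\land D \mid D\lor D \mid \exists x\, D \mid \forall x\, D$; so universal quantifiers do not occur positively in $G$-formulas or negatively in $D$-formulas. Fix the $G$-formula $G$ of the end sequent. The $\mathbf{I}_G$ calculus is the single-succedent (intuitionistic) sequent calculus above, modified by adding the two rules $\lor$-L$_G$: from $B,\Delta\longrightarrow F$ and $D,\Delta\longrightarrow G$ infer $B\lor D,\Delta\longrightarrow F$; res$_G$: from $\Delta\longrightarrow G$ infer $\Delta\longrightarrow F$; and by strengthening the proviso on $\exists$-L and $\forall$-R so that the new constant also may not appear in $G$. An $\mathbf{I}_G$-proof is a derivation in this calculus that, moreover, contains no occurrences of the ordinary $\lor$-L rule (this rule is shown redundant for such sequents: any $\lor$-L occurrence can be eliminated in favour of $\lor$-L$_G$). These two rules are derived intuitionistic rules when the antecedent contains $G\supset\bot$, so $\mathbf{I}_G$-proofs implicitly represent I-proofs of $G\supset\bot,\Gamma\longrightarrow G$. -}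

module Defs where

open import Data.Nat using (ℕ; zero; suc)
open import Data.Fin using (Fin; zero; suc)
open import Data.List using (List; []; _∷_; _++_; [_])
open import Data.List.Membership.Propositional using (_∈_; _∉_)
open import Data.List.Relation.Binary.Permutation.Propositional using (_↭_)

-- First-order language: countably many constants (used, among others,
-- as eigenvariables), function symbols and predicate symbols, each named
-- by a natural number.

data Term (n : ℕ) : Set where
  var : Fin n → Term n
  con : ℕ → Term n
  fun : ℕ → List (Term n) → Term n

infixr 6 _∧'_
infixr 5 _∨'_
infixr 4 _⊃'_

data Formula (n : ℕ) : Set where
  ⊤'   : Formula n
  ⊥'   : Formula n
  atom : ℕ → List (Term n) → Formula n
  _∧'_ : Formula n → Formula n → Formula n
  _∨'_ : Formula n → Formula n → Formula n
  _⊃'_ : Formula n → Formula n → Formula n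
  ex   : Formula (suc n) → Formula n
  all  : Formula (suc n) → Formula n

Fm : Set
Fm = Formula 0

mutual
  renT : ∀ {n m} → (Fin n → Fin m) → Term n → Term m
  renT ρ (var i)    = var (ρ i)
  renT ρ (con c)    = con c
  renT ρ (fun f ts) = fun f (renTs ρ ts)

  renTs : ∀ {n m} → (Fin n → Fin m) → List (Term n) → List (Term m)
  renTs ρ []       = []
  renTs ρ (t ∷ ts) = renT ρ t ∷ renTs ρ ts

mutual
  subT : ∀ {n m} → (Fin n → Term m) → Term n → Term m
  subT σ (var i)    = σ i
  subT σ (con c)    = con c
  subT σ (fun f ts) = fun f (subTs σ ts)

  subTs : ∀ {n m} → (Fin n → Term m) → List (Term n) → List (Term m)
  subTs σ []       = []
  subTs σ (t ∷ ts) = subT σ t ∷ subTs σ ts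

lift : ∀ {n m} → (Fin n → Term m) → Fin (suc n) → Term (suc m)
lift σ zero    = var zero
lift σ (suc i) = renT suc (σ i)

subF : ∀ {n m} → (Fin n → Term m) → Formula n → Formula m
subF σ ⊤'          = ⊤'
subF σ ⊥'          = ⊥'
subF σ (atom p ts) = atom p (subTs σ ts)
subF σ (A ∧' B)    = subF σ A ∧' subF σ B
subF σ (A ∨' B)    = subF σ A ∨' subF σ B
subF σ (A ⊃' B)    = subF σ A ⊃' subF σ B
subF σ (ex B)      = ex (subF (lift σ) B)
subF σ (all B)     = all (subF (lift σ) B)

sub0 : ∀ {n} → Term n → Fin (suc n) → Term n
sub0 t zero    = t
sub0 t (suc i) = var i

inst : ∀ {n} → Formula (suc n) → Term n → Formula n
inst B t = subF (sub0 t) B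

mutual
  constsT : ∀ {n} → Term n → List ℕ
  constsT (var i)    = []
  constsT (con c)    = c ∷ []
  constsT (fun f ts) = constsTs ts

  constsTs : ∀ {n} → List (Term n) → List ℕ
  constsTs []       = []
  constsTs (t ∷ ts) = constsT t ++ constsTs ts

constsF : ∀ {n} → Formula n → List ℕ
constsF ⊤'          = []
constsF ⊥'          = []
constsF (atom p ts) = constsTs ts
constsF (A ∧' B)    = constsF A ++ constsF B
constsF (A ∨' B)    = constsF A ++ constsF B
constsF (A ⊃' B)    = constsF A ++ constsF B
constsF (ex B)      = constsF B
constsF (all B)     = constsF B

constsL : List Fm → List ℕ
constsL []       = []
constsL (A ∷ Γ)  = constsF A ++ constsL Γ

mutual
  data IsG {n : ℕ} : Formula n → Set where
    g⊤ : IsG ⊤'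
    g⊥ : IsG ⊥'
    gA : ∀ {p ts} → IsG (atom p ts)
    g∧ : ∀ {A B} → IsG A → IsG B → IsG (A ∧' B)
    g∨ : ∀ {A B} → IsG A → IsG B → IsG (A ∨' B)
    g⊃ : ∀ {A B} → IsD A → IsG B → IsG (A ⊃' B)
    g∃ : ∀ {B} → IsG B → IsG (ex B)

  data IsD {n : ℕ} : Formula n → Set where
    d⊤ : IsD ⊤'
    d⊥ : IsD ⊥'
    dA : ∀ {p ts} → IsD (atom p ts)
    d⊃ : ∀ {A B} → IsG A → IsD B → IsD (A ⊃' B)
    d∧ : ∀ {A B} → IsD A → IsD B → IsD (A ∧' B)
    d∨ : ∀ {A B} → IsD A → IsD B → IsD (A ∨' B)
    d∃ : ∀ {B} → IsD B → IsD (ex B)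
    d∀ : ∀ {B} → IsD B → IsD (all B)

data AtomOr⊥ : Fm → Set where
  is⊥    : AtomOr⊥ ⊥'
  isAtom : ∀ {p ts} → AtomOr⊥ (atom p ts)

-- C-proofs.  Sequents are pairs of multisets, represented by lists
-- modulo permutation (rule 'exch').  Principal formulas are written
-- at the front of the lists.

infix 2 _⟹_

data _⟹_ : List Fm → List Fm → Set where
  ax⊤  : ∀ {Γ Δ} → ⊤' ∈ Δ → Γ ⟹ Δ
  ax   : ∀ {Γ Δ A} → AtomOr⊥ A → A ∈ Γ → A ∈ Δ → Γ ⟹ Δ
  exch : ∀ {Γ Γ' Δ Δ'} → Γ ↭ Γ' → Δ ↭ Δ' → Γ ⟹ Δ → Γ' ⟹ Δ'
  cL   : ∀ {Γ Δ A} → A ∷ A ∷ Γ ⟹ Δ → A ∷ Γ ⟹ Δ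
  cR   : ∀ {Γ Δ A} → Γ ⟹ A ∷ A ∷ Δ → Γ ⟹ A ∷ Δ
  ⊥R   : ∀ {Γ Δ} D → Γ ⟹ ⊥' ∷ Δ → Γ ⟹ D ∷ Δ
  ∧L   : ∀ {Γ Δ B D} → B ∷ D ∷ (B ∧' D) ∷ Γ ⟹ Δ → (B ∧' D) ∷ Γ ⟹ Δ
  ∧R   : ∀ {Γ Δ B D} → Γ ⟹ B ∷ Δ → Γ ⟹ D ∷ Δ → Γ ⟹ (B ∧' D) ∷ Δ
  ∨L   : ∀ {Γ Δ B D} → B ∷ Γ ⟹ Δ → D ∷ Γ ⟹ Δ → (B ∨' D) ∷ Γ ⟹ Δ
  ∨R₁  : ∀ {Γ Δ B} D → Γ ⟹ B ∷ Δ → Γ ⟹ (B ∨' D) ∷ Δ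
  ∨R₂  : ∀ {Γ Δ D} B → Γ ⟹ D ∷ Δ → Γ ⟹ (B ∨' D) ∷ Δ
  ⊃L   : ∀ {Γ Δ Θ B D} → (B ⊃' D) ∷ Γ ⟹ B ∷ Δ → D ∷ Γ ⟹ Θ
         → (B ⊃' D) ∷ Γ ⟹ Δ ++ Θ
  ⊃R   : ∀ {Γ Δ B D} → B ∷ Γ ⟹ D ∷ Δ → Γ ⟹ (B ⊃' D) ∷ Δ
  ∀L   : ∀ {Γ Δ B} (t : Term 0) → inst B t ∷ all B ∷ Γ ⟹ Δ → all B ∷ Γ ⟹ Δ
  ∃R   : ∀ {Γ Δ B} (t : Term 0) → Γ ⟹ inst B t ∷ Δ → Γ ⟹ ex B ∷ Δ
  ∃L   : ∀ {Γ Δ B} (c : ℕ) → c ∉ constsL (ex B ∷ Γ) ++ constsL Δ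
         → inst B (con c) ∷ Γ ⟹ Δ → ex B ∷ Γ ⟹ Δ
  ∀R   : ∀ {Γ Δ B} (c : ℕ) → c ∉ constsL Γ ++ constsL (all B ∷ Δ)
         → Γ ⟹ inst B (con c) ∷ Δ → Γ ⟹ all B ∷ Δ

-- I_G-proofs: single-succedent calculus relative to the fixed G-formula
-- G, without the ordinary ∨-L rule, with ∨-L_G and res_G, and with the
-- eigenvariable proviso strengthened to exclude constants of G.

data IG (G : Fm) : List Fm → Fm → Set where
  ax⊤  : ∀ {Γ} → IG G Γ ⊤'
  ax   : ∀ {Γ A} → AtomOr⊥ A → A ∈ Γ → IG G Γ A
  exch : ∀ {Γ Γ' F} → Γ ↭ Γ' → IG G Γ F → IG G Γ' F
  cL   : ∀ {Γ A F} → IG G (A ∷ A ∷ Γ) F → IG G (A ∷ Γ) F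
  ⊥R   : ∀ {Γ} F → IG G Γ ⊥' → IG G Γ F
  ∧L   : ∀ {Γ F B D} → IG G (B ∷ D ∷ (B ∧' D) ∷ Γ) F → IG G ((B ∧' D) ∷ Γ) F
  ∧R   : ∀ {Γ B D} → IG G Γ B → IG G Γ D → IG G Γ (B ∧' D)
  ∨R₁  : ∀ {Γ B} D → IG G Γ B → IG G Γ (B ∨' D)
  ∨R₂  : ∀ {Γ D} B → IG G Γ D → IG G Γ (B ∨' D)
  ⊃L   : ∀ {Γ F B D} → IG G ((B ⊃' D) ∷ Γ) B → IG G (D ∷ Γ) F
         → IG G ((B ⊃' D) ∷ Γ) F
  ⊃R   : ∀ {Γ B D} → IG G (B ∷ Γ) D → IG G Γ (B ⊃' D)
  ∀L   : ∀ {Γ F B} (t : Term 0) → IG G (inst B t ∷ all B ∷ Γ) F → IG G (all B ∷ Γ) F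
  ∃R   : ∀ {Γ B} (t : Term 0) → IG G Γ (inst B t) → IG G Γ (ex B)
  ∃L   : ∀ {Γ F B} (c : ℕ) → c ∉ constsL (ex B ∷ Γ) ++ constsF F ++ constsF G
         → IG G (inst B (con c) ∷ Γ) F → IG G (ex B ∷ Γ) F
  ∀R   : ∀ {Γ B} (c : ℕ) → c ∉ constsL Γ ++ constsF (all B) ++ constsF G
         → IG G Γ (inst B (con c)) → IG G Γ (all B)
  ∨LG  : ∀ {Γ F B D} → IG G (B ∷ Γ) F → IG G (D ∷ Γ) G → IG G ((B ∨' D) ∷ Γ) F
  resG : ∀ {Γ} F → IG G Γ G → IG G Γ F

-- An I_G-proof becomes a C-proof once G is carried along as an extra succedent
-- formula: res_G and ∨-L_G turn into contraction followed by ⊥-R, and ⊃-L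
-- hands the spare G to its left premise.
--
-- Conversely, a classical sequent Γ ⟹ Δ of D-formulas Γ and G-formulas Δ is
-- read as "Γ together with the G-negations of Δ proves G", where H is
-- G-refuted over a context if every extension in which H is persistently
-- provable proves G.  Each C-rule preserves this reading (⊃-R by way of res_G,
-- ∨-L by way of ∨-L_G) except ∀-R, which cannot occur since G-formulas have no
-- positive ∀.  Eigenvariables are handled by closing the reading under
-- renamings of constants.  The G-negation of G itself is trivial, so for
-- Δ = [ G ] the reading is an I_G-proof.

module Submission where

open import Defs
open import Data.Empty using (⊥-elim)
open import Data.Fin using (Fin; zero; suc)
open import Data.List using (List; []; _∷_; _++_; [_]; map; replicate)
open import Data.List.Extrema.Nat using (max; xs≤max)
open import Data.List.Membership.Propositional using (_∈_; _∉_)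
open import Data.List.Membership.Propositional.Properties
  using (∈-++⁺ˡ; ∈-++⁺ʳ; ∈-map⁺; ∈-∃++)
open import Data.List.Properties using (++-identityʳ; map-++; map-cong; map-id)
open import Data.List.Relation.Binary.Permutation.Propositional
  using (_↭_; prep; swap; ↭-refl; ↭-sym)
open import Data.List.Relation.Binary.Permutation.Propositional.Properties
  using (All-resp-↭; shift) renaming (map⁺ to ↭-map⁺)
open import Data.List.Relation.Binary.Subset.Propositional using (_⊆_)
open import Data.List.Relation.Binary.Subset.Propositional.Properties
  using (⊆-refl; ⊆-trans; ⊆-reflexive-↭; ∷⁺ʳ; ∈-∷⁺ʳ; xs⊆x∷xs; xs⊆ys++xs; ++⁺ʳ)
open import Data.List.Relation.Unary.All as All using (All; []; _∷_)
open import Data.List.Relation.Unary.All.Properties using (++⁻; ++⁻ˡ; ++⁻ʳ)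
open import Data.List.Relation.Unary.Any using (here; there)
open import Data.Nat using (ℕ; zero; suc; _≟_)
open import Data.Nat.Properties using (1+n≰n)
open import Data.Product using (∃; _,_)
open import Function using (_∘_; id)
open import Function.Bundles using (_⇔_; mk⇔)
open import Relation.Nullary using (yes; no)
open import Relation.Binary.PropositionalEquality
  using (_≡_; _≢_; refl; sym; trans; cong; cong₂; subst; subst₂; module ≡-Reasoning)

private
  variable
    n m : ℕ
    G F A B D H K : Fm
    Γ Γ' Δ Θ : List Fm

-- From I_G to C

constsL-replicate-⊥ : ∀ n → constsL (replicate n ⊥') ≡ []
constsL-replicate-⊥ zero    = refl
constsL-replicate-⊥ (suc n) = constsL-replicate-⊥ n

∉-++-⊥s : ∀ {c} n X Y Z → c ∉ X ++ Y ++ Z → c ∉ X ++ Y ++ Z ++ constsL (replicate n ⊥')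
∉-++-⊥s n X Y Z c∉ rewrite constsL-replicate-⊥ n | ++-identityʳ Z = c∉

⟹-resG : ∀ F → Γ ⟹ G ∷ G ∷ ⊥' ∷ Δ → Γ ⟹ F ∷ G ∷ Δ
⟹-resG {G = G} F d = ⊥R F (exch ↭-refl (swap G ⊥' ↭-refl) (cR d))

-- C has no weakening: the spare ⊥'s in the succedent are what lets ⊥-R
-- introduce F where res_G and ∨-L_G replace it by G.
IG⇒⟹ : IG G Γ F → ∀ n → Γ ⟹ F ∷ G ∷ replicate n ⊥'
IG⇒⟹ ax⊤            n = ax⊤ (here refl)
IG⇒⟹ (ax a A∈Γ)     n = ax a A∈Γ (here refl)
IG⇒⟹ (exch p d)     n = exch p ↭-refl (IG⇒⟹ d n)
IG⇒⟹ (cL d)         n = cL (IG⇒⟹ d n)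
IG⇒⟹ (⊥R F d)       n = ⊥R F (IG⇒⟹ d n)
IG⇒⟹ (∧L d)         n = ∧L (IG⇒⟹ d n)
IG⇒⟹ (∧R d e)       n = ∧R (IG⇒⟹ d n) (IG⇒⟹ e n)
IG⇒⟹ (∨R₁ D d)      n = ∨R₁ D (IG⇒⟹ d n)
IG⇒⟹ (∨R₂ B d)      n = ∨R₂ B (IG⇒⟹ d n)
IG⇒⟹ {G} {F = F} (⊃L d e) n =
  exch ↭-refl (swap G F ↭-refl)
    (cR (exch ↭-refl (prep G (swap F G ↭-refl)) (⊃L (IG⇒⟹ d 0) (IG⇒⟹ e n))))
IG⇒⟹ (⊃R d)         n = ⊃R (IG⇒⟹ d n)
IG⇒⟹ (∀L t d)       n = ∀L t (IG⇒⟹ d n)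
IG⇒⟹ (∃R t d)       n = ∃R t (IG⇒⟹ d n)
IG⇒⟹ {G} {ex B ∷ Γ} {F} (∃L c c∉ d) n =
  ∃L c (∉-++-⊥s n (constsL (ex B ∷ Γ)) (constsF F) (constsF G) c∉) (IG⇒⟹ d n)
IG⇒⟹ {G} {Γ} {all B} (∀R c c∉ d) n =
  ∀R c (∉-++-⊥s n (constsL Γ) (constsF B) (constsF G) c∉) (IG⇒⟹ d n)
IG⇒⟹ {F = F} (∨LG d e) n = ∨L (IG⇒⟹ d n) (⟹-resG F (IG⇒⟹ e (suc n)))
IG⇒⟹ (resG F d)     n = ⟹-resG F (IG⇒⟹ d (suc n))

-- Renaming constants

mutual
  mapConT : (ℕ → ℕ) → Term n → Term n
  mapConT ρ (var i)    = var i
  mapConT ρ (con c)    = con (ρ c)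
  mapConT ρ (fun f ts) = fun f (mapConTs ρ ts)

  mapConTs : (ℕ → ℕ) → List (Term n) → List (Term n)
  mapConTs ρ []       = []
  mapConTs ρ (t ∷ ts) = mapConT ρ t ∷ mapConTs ρ ts

mapConF : (ℕ → ℕ) → Formula n → Formula n
mapConF ρ ⊤'          = ⊤'
mapConF ρ ⊥'          = ⊥'
mapConF ρ (atom p ts) = atom p (mapConTs ρ ts)
mapConF ρ (A ∧' B)    = mapConF ρ A ∧' mapConF ρ B
mapConF ρ (A ∨' B)    = mapConF ρ A ∨' mapConF ρ B
mapConF ρ (A ⊃' B)    = mapConF ρ A ⊃' mapConF ρ B
mapConF ρ (ex B)      = ex (mapConF ρ B)
mapConF ρ (all B)     = all (mapConF ρ B)

mutual
  mapConT-renT : ∀ ρ (f : Fin n → Fin m) t → mapConT ρ (renT f t) ≡ renT f (mapConT ρ t)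
  mapConT-renT ρ f (var i)    = refl
  mapConT-renT ρ f (con c)    = refl
  mapConT-renT ρ f (fun g ts) = cong (fun g) (mapConTs-renTs ρ f ts)

  mapConTs-renTs : ∀ ρ (f : Fin n → Fin m) ts → mapConTs ρ (renTs f ts) ≡ renTs f (mapConTs ρ ts)
  mapConTs-renTs ρ f []       = refl
  mapConTs-renTs ρ f (t ∷ ts) = cong₂ _∷_ (mapConT-renT ρ f t) (mapConTs-renTs ρ f ts)

module _ (ρ : ℕ → ℕ) where

  mutual
    mapConT-subT : {σ τ : Fin n → Term m} → (∀ i → mapConT ρ (σ i) ≡ τ i) →
                   ∀ t → mapConT ρ (subT σ t) ≡ subT τ (mapConT ρ t)
    mapConT-subT eq (var i)    = eq i
    mapConT-subT eq (con c)    = refl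
    mapConT-subT eq (fun g ts) = cong (fun g) (mapConTs-subTs eq ts)

    mapConTs-subTs : {σ τ : Fin n → Term m} → (∀ i → mapConT ρ (σ i) ≡ τ i) →
                     ∀ ts → mapConTs ρ (subTs σ ts) ≡ subTs τ (mapConTs ρ ts)
    mapConTs-subTs eq []       = refl
    mapConTs-subTs eq (t ∷ ts) = cong₂ _∷_ (mapConT-subT eq t) (mapConTs-subTs eq ts)

  mapConT-lift : {σ τ : Fin n → Term m} → (∀ i → mapConT ρ (σ i) ≡ τ i) →
                 ∀ i → mapConT ρ (lift σ i) ≡ lift τ i
  mapConT-lift eq zero    = refl
  mapConT-lift eq (suc i) = trans (mapConT-renT ρ suc _) (cong (renT suc) (eq i))

  mapConF-subF : {σ τ : Fin n → Term m} → (∀ i → mapConT ρ (σ i) ≡ τ i) →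
                 ∀ A → mapConF ρ (subF σ A) ≡ subF τ (mapConF ρ A)
  mapConF-subF eq ⊤'          = refl
  mapConF-subF eq ⊥'          = refl
  mapConF-subF eq (atom p ts) = cong (atom p) (mapConTs-subTs eq ts)
  mapConF-subF eq (A ∧' B)    = cong₂ _∧'_ (mapConF-subF eq A) (mapConF-subF eq B)
  mapConF-subF eq (A ∨' B)    = cong₂ _∨'_ (mapConF-subF eq A) (mapConF-subF eq B)
  mapConF-subF eq (A ⊃' B)    = cong₂ _⊃'_ (mapConF-subF eq A) (mapConF-subF eq B)
  mapConF-subF eq (ex B)      = cong ex (mapConF-subF (mapConT-lift eq) B)
  mapConF-subF eq (all B)     = cong all (mapConF-subF (mapConT-lift eq) B)

  mapConF-inst : ∀ (B : Formula (suc n)) t → mapConF ρ (inst B t) ≡ inst (mapConF ρ B) (mapConT ρ t)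
  mapConF-inst B t = mapConF-subF (λ { zero → refl ; (suc i) → refl }) B

  mapConF-AtomOr⊥ : AtomOr⊥ A → AtomOr⊥ (mapConF ρ A)
  mapConF-AtomOr⊥ is⊥    = is⊥
  mapConF-AtomOr⊥ isAtom = isAtom

module _ {ρ ρ' : ℕ → ℕ} where

  mutual
    mapConT-cong : ∀ (t : Term n) → (∀ {c} → c ∈ constsT t → ρ c ≡ ρ' c) →
                   mapConT ρ t ≡ mapConT ρ' t
    mapConT-cong (var i)    eq = refl
    mapConT-cong (con c)    eq = cong con (eq (here refl))
    mapConT-cong (fun g ts) eq = cong (fun g) (mapConTs-cong ts eq)

    mapConTs-cong : ∀ (ts : List (Term n)) → (∀ {c} → c ∈ constsTs ts → ρ c ≡ ρ' c) →
                    mapConTs ρ ts ≡ mapConTs ρ' ts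
    mapConTs-cong []       eq = refl
    mapConTs-cong (t ∷ ts) eq =
      cong₂ _∷_ (mapConT-cong t (eq ∘ ∈-++⁺ˡ)) (mapConTs-cong ts (eq ∘ ∈-++⁺ʳ (constsT t)))

  mapConF-cong : ∀ (A : Formula n) → (∀ {c} → c ∈ constsF A → ρ c ≡ ρ' c) →
                 mapConF ρ A ≡ mapConF ρ' A
  mapConF-cong ⊤'          eq = refl
  mapConF-cong ⊥'          eq = refl
  mapConF-cong (atom p ts) eq = cong (atom p) (mapConTs-cong ts eq)
  mapConF-cong (A ∧' B)    eq =
    cong₂ _∧'_ (mapConF-cong A (eq ∘ ∈-++⁺ˡ)) (mapConF-cong B (eq ∘ ∈-++⁺ʳ (constsF A)))
  mapConF-cong (A ∨' B)    eq =
    cong₂ _∨'_ (mapConF-cong A (eq ∘ ∈-++⁺ˡ)) (mapConF-cong B (eq ∘ ∈-++⁺ʳ (constsF A)))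
  mapConF-cong (A ⊃' B)    eq =
    cong₂ _⊃'_ (mapConF-cong A (eq ∘ ∈-++⁺ˡ)) (mapConF-cong B (eq ∘ ∈-++⁺ʳ (constsF A)))
  mapConF-cong (ex B)      eq = cong ex (mapConF-cong B eq)
  mapConF-cong (all B)     eq = cong all (mapConF-cong B eq)

mutual
  mapConT-id : ∀ (t : Term n) → mapConT id t ≡ t
  mapConT-id (var i)    = refl
  mapConT-id (con c)    = refl
  mapConT-id (fun g ts) = cong (fun g) (mapConTs-id ts)

  mapConTs-id : ∀ (ts : List (Term n)) → mapConTs id ts ≡ ts
  mapConTs-id []       = refl
  mapConTs-id (t ∷ ts) = cong₂ _∷_ (mapConT-id t) (mapConTs-id ts)

mapConF-id : ∀ (A : Formula n) → mapConF id A ≡ A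
mapConF-id ⊤'          = refl
mapConF-id ⊥'          = refl
mapConF-id (atom p ts) = cong (atom p) (mapConTs-id ts)
mapConF-id (A ∧' B)    = cong₂ _∧'_ (mapConF-id A) (mapConF-id B)
mapConF-id (A ∨' B)    = cong₂ _∨'_ (mapConF-id A) (mapConF-id B)
mapConF-id (A ⊃' B)    = cong₂ _⊃'_ (mapConF-id A) (mapConF-id B)
mapConF-id (ex B)      = cong ex (mapConF-id B)
mapConF-id (all B)     = cong all (mapConF-id B)

map-mapConF-id : ∀ (Γ : List Fm) → map (mapConF id) Γ ≡ Γ
map-mapConF-id Γ = trans (map-cong mapConF-id Γ) (map-id Γ)

fresh : (cs : List ℕ) → ∃ λ c → c ∉ cs
fresh cs = suc (max 0 cs) , λ c∈cs → 1+n≰n (All.lookup (xs≤max 0 cs) c∈cs)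

_[_≔_] : (ℕ → ℕ) → ℕ → ℕ → ℕ → ℕ
(ρ [ c ≔ c' ]) x with x ≟ c
... | yes _ = c'
... | no  _ = ρ x

≔-hit : ∀ ρ c c' → (ρ [ c ≔ c' ]) c ≡ c'
≔-hit ρ c c' with c ≟ c
... | yes _   = refl
... | no  c≢c = ⊥-elim (c≢c refl)

≔-miss : ∀ ρ {c} c' {x} → x ≢ c → (ρ [ c ≔ c' ]) x ≡ ρ x
≔-miss ρ {c} c' {x} x≢c with x ≟ c
... | yes x≡c = ⊥-elim (x≢c x≡c)
... | no  _   = refl

module _ (ρ : ℕ → ℕ) {c : ℕ} (c' : ℕ) where

  mapConF-≔-fresh : ∀ (A : Formula n) → c ∉ constsF A → mapConF (ρ [ c ≔ c' ]) A ≡ mapConF ρ A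
  mapConF-≔-fresh A c∉A = mapConF-cong A (λ x∈A → ≔-miss ρ c' λ { refl → c∉A x∈A })

  map-mapConF-≔-fresh : ∀ (Γ : List Fm) → c ∉ constsL Γ → map (mapConF (ρ [ c ≔ c' ])) Γ ≡ map (mapConF ρ) Γ
  map-mapConF-≔-fresh []      c∉ = refl
  map-mapConF-≔-fresh (A ∷ Γ) c∉ =
    cong₂ _∷_ (mapConF-≔-fresh A (c∉ ∘ ∈-++⁺ˡ)) (map-mapConF-≔-fresh Γ (c∉ ∘ ∈-++⁺ʳ (constsF A)))

  mapConF-≔-inst : ∀ (B : Formula (suc n)) → c ∉ constsF B →
                   mapConF (ρ [ c ≔ c' ]) (inst B (con c)) ≡ inst (mapConF ρ B) (con c')
  mapConF-≔-inst B c∉B = begin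
    mapConF (ρ [ c ≔ c' ]) (inst B (con c))                ≡⟨ mapConF-inst _ B (con c) ⟩
    inst (mapConF (ρ [ c ≔ c' ]) B) (con ((ρ [ c ≔ c' ]) c)) ≡⟨ cong₂ inst (mapConF-≔-fresh B c∉B) (cong con (≔-hit ρ c c')) ⟩
    inst (mapConF ρ B) (con c')                             ∎
    where open ≡-Reasoning

-- From C to I_G

mutual
  IsG-subF : ∀ (σ : Fin n → Term m) {A : Formula n} → IsG A → IsG (subF σ A)
  IsG-subF σ g⊤       = g⊤
  IsG-subF σ g⊥       = g⊥
  IsG-subF σ gA       = gA
  IsG-subF σ (g∧ a b) = g∧ (IsG-subF σ a) (IsG-subF σ b)
  IsG-subF σ (g∨ a b) = g∨ (IsG-subF σ a) (IsG-subF σ b)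
  IsG-subF σ (g⊃ a b) = g⊃ (IsD-subF σ a) (IsG-subF σ b)
  IsG-subF σ (g∃ a)   = g∃ (IsG-subF (lift σ) a)

  IsD-subF : ∀ (σ : Fin n → Term m) {A : Formula n} → IsD A → IsD (subF σ A)
  IsD-subF σ d⊤       = d⊤
  IsD-subF σ d⊥       = d⊥
  IsD-subF σ dA       = dA
  IsD-subF σ (d⊃ a b) = d⊃ (IsG-subF σ a) (IsD-subF σ b)
  IsD-subF σ (d∧ a b) = d∧ (IsD-subF σ a) (IsD-subF σ b)
  IsD-subF σ (d∨ a b) = d∨ (IsD-subF σ a) (IsD-subF σ b)
  IsD-subF σ (d∃ a)   = d∃ (IsD-subF (lift σ) a)
  IsD-subF σ (d∀ a)   = d∀ (IsD-subF (lift σ) a)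

IG-absorb : A ∈ Γ → IG G (A ∷ Γ) F → IG G Γ F
IG-absorb {A} A∈Γ d with ys , zs , refl ← ∈-∃++ A∈Γ =
  exch (↭-sym (shift A ys zs)) (cL (exch (prep A (shift A ys zs)) d))

module _ (G : Fm) where

  Persistent : List Fm → Fm → Set
  Persistent Γ H = ∀ Γ' → Γ ⊆ Γ' → IG G Γ' H

  Refuted : List Fm → Fm → Set
  Refuted Γ H = ∀ Γ' → Γ ⊆ Γ' → Persistent Γ' H → IG G Γ' G

  infix 2 _⊩_ _⊩ʳ_

  _⊩_ : List Fm → List Fm → Set
  Γ ⊩ Δ = ∀ Γ' → Γ ⊆ Γ' → All (Refuted Γ') Δ → IG G Γ' G

  -- Closing under renamings lets an eigenvariable of the C-proof be moved to a
  -- constant fresh for the current context and for G (see ⊩ʳ-∃L).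
  _⊩ʳ_ : List Fm → List Fm → Set
  Γ ⊩ʳ Δ = ∀ ρ → map (mapConF ρ) Γ ⊩ map (mapConF ρ) Δ

  Persistent-mono : Γ ⊆ Γ' → Persistent Γ H → Persistent Γ' H
  Persistent-mono Γ⊆Γ' p Γ'' Γ'⊆Γ'' = p Γ'' (⊆-trans Γ⊆Γ' Γ'⊆Γ'')

  Persistent-map : (∀ {Γ} → IG G Γ H → IG G Γ K) → Persistent Γ H → Persistent Γ K
  Persistent-map f p Γ' Γ⊆Γ' = f (p Γ' Γ⊆Γ')

  Persistent-∧ : Persistent Γ B → Persistent Γ D → Persistent Γ (B ∧' D)
  Persistent-∧ p q Γ' Γ⊆Γ' = ∧R (p Γ' Γ⊆Γ') (q Γ' Γ⊆Γ')

  Persistent-⊃ : Persistent (B ∷ Γ) D → Persistent Γ (B ⊃' D)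
  Persistent-⊃ {B} p Γ' Γ⊆Γ' = ⊃R (p (B ∷ Γ') (∷⁺ʳ B Γ⊆Γ'))

  Refuted-mono : Γ ⊆ Γ' → Refuted Γ H → Refuted Γ' H
  Refuted-mono Γ⊆Γ' r Γ'' Γ'⊆Γ'' = r Γ'' (⊆-trans Γ⊆Γ' Γ'⊆Γ'')

  Refuted-contra : (∀ {Γ'} → Γ ⊆ Γ' → Persistent Γ' H → Persistent Γ' K) →
                   Refuted Γ K → Refuted Γ H
  Refuted-contra f r Γ' Γ⊆Γ' p = r Γ' Γ⊆Γ' (f Γ⊆Γ' p)

  Refuted-goal : Refuted Γ G
  Refuted-goal Γ' _ p = p Γ' ⊆-refl

  refute : Refuted Γ H → Persistent Γ H → IG G Γ G
  refute r = r _ ⊆-refl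

  ⊩-under : ∀ Σ → Σ ++ Γ ⊩ Δ → Γ ⊆ Γ' → All (Refuted Γ') Δ → IG G (Σ ++ Γ') G
  ⊩-under {Γ' = Γ'} Σ d Γ⊆Γ' rs =
    d (Σ ++ Γ') (++⁺ʳ Σ Γ⊆Γ') (All.map (Refuted-mono (xs⊆ys++xs Γ' Σ)) rs)

  ⊩-ax⊤ : ⊤' ∈ Δ → Γ ⊩ Δ
  ⊩-ax⊤ ⊤∈Δ Γ' _ rs = refute (All.lookup rs ⊤∈Δ) (λ _ _ → ax⊤)

  ⊩-ax : AtomOr⊥ A → A ∈ Γ → A ∈ Δ → Γ ⊩ Δ
  ⊩-ax a A∈Γ A∈Δ Γ' Γ⊆Γ' rs =
    refute (All.lookup rs A∈Δ) (λ Γ'' Γ'⊆Γ'' → ax a (Γ'⊆Γ'' (Γ⊆Γ' A∈Γ)))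

  ⊩-exch : ∀ {Γ₁ Γ₂ Δ₁ Δ₂} → Γ₁ ↭ Γ₂ → Δ₁ ↭ Δ₂ → Γ₁ ⊩ Δ₁ → Γ₂ ⊩ Δ₂
  ⊩-exch p q d Γ' Γ₂⊆Γ' rs = d Γ' (⊆-trans (⊆-reflexive-↭ p) Γ₂⊆Γ') (All-resp-↭ (↭-sym q) rs)

  ⊩-cL : A ∷ A ∷ Γ ⊩ Δ → A ∷ Γ ⊩ Δ
  ⊩-cL d Γ' A∷Γ⊆Γ' = d Γ' (∈-∷⁺ʳ (A∷Γ⊆Γ' (here refl)) A∷Γ⊆Γ')

  ⊩-cR : Γ ⊩ A ∷ A ∷ Δ → Γ ⊩ A ∷ Δ
  ⊩-cR d Γ' Γ⊆Γ' (r ∷ rs) = d Γ' Γ⊆Γ' (r ∷ r ∷ rs)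

  ⊩-⊥R : Γ ⊩ ⊥' ∷ Δ → Γ ⊩ D ∷ Δ
  ⊩-⊥R {D = D} d Γ' Γ⊆Γ' (r ∷ rs) =
    d Γ' Γ⊆Γ' (Refuted-contra (λ _ → Persistent-map (⊥R D)) r ∷ rs)

  ⊩-∧L : B ∷ D ∷ B ∧' D ∷ Γ ⊩ Δ → B ∧' D ∷ Γ ⊩ Δ
  ⊩-∧L {B} {D} d Γ' B∧D∷Γ⊆Γ' rs =
    IG-absorb (B∧D∷Γ⊆Γ' (here refl)) (∧L (⊩-under (B ∷ D ∷ [ B ∧' D ]) d (B∧D∷Γ⊆Γ' ∘ there) rs))

  ⊩-∧R : Γ ⊩ B ∷ Δ → Γ ⊩ D ∷ Δ → Γ ⊩ B ∧' D ∷ Δ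
  ⊩-∧R {B = B} d e Γ' Γ⊆Γ' (r ∷ rs) = d Γ' Γ⊆Γ' (rB ∷ rs)
    where
    rB : Refuted Γ' B
    rB Γ'' Γ'⊆Γ'' pB =
      e Γ'' (⊆-trans Γ⊆Γ' Γ'⊆Γ'')
        ( Refuted-contra (λ Γ''⊆Γ₃ → Persistent-∧ (Persistent-mono Γ''⊆Γ₃ pB)) (Refuted-mono Γ'⊆Γ'' r)
        ∷ All.map (Refuted-mono Γ'⊆Γ'') rs)

  ⊩-∨L : B ∷ Γ ⊩ Δ → D ∷ Γ ⊩ Δ → (B ∨' D) ∷ Γ ⊩ Δ
  ⊩-∨L {B} {D = D} d e Γ' B∨D∷Γ⊆Γ' rs =
    IG-absorb (B∨D∷Γ⊆Γ' (here refl))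
      (∨LG (⊩-under [ B ] d (B∨D∷Γ⊆Γ' ∘ there) rs) (⊩-under [ D ] e (B∨D∷Γ⊆Γ' ∘ there) rs))

  ⊩-∨R₁ : Γ ⊩ B ∷ Δ → Γ ⊩ (B ∨' D) ∷ Δ
  ⊩-∨R₁ {D = D} d Γ' Γ⊆Γ' (r ∷ rs) =
    d Γ' Γ⊆Γ' (Refuted-contra (λ _ → Persistent-map (∨R₁ D)) r ∷ rs)

  ⊩-∨R₂ : Γ ⊩ D ∷ Δ → Γ ⊩ (B ∨' D) ∷ Δ
  ⊩-∨R₂ {B = B} d Γ' Γ⊆Γ' (r ∷ rs) =
    d Γ' Γ⊆Γ' (Refuted-contra (λ _ → Persistent-map (∨R₂ B)) r ∷ rs)

  ⊩-⊃L : (B ⊃' D) ∷ Γ ⊩ B ∷ Δ → D ∷ Γ ⊩ Θ → (B ⊃' D) ∷ Γ ⊩ Δ ++ Θ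
  ⊩-⊃L {B} {D} {Δ = Δ} d e Γ' B⊃D∷Γ⊆Γ' rs with rΔ , rΘ ← ++⁻ Δ rs = d Γ' B⊃D∷Γ⊆Γ' (rB ∷ rΔ)
    where
    rB : Refuted Γ' B
    rB Γ'' Γ'⊆Γ'' pB =
      IG-absorb (Γ'⊆Γ'' (B⊃D∷Γ⊆Γ' (here refl)))
        (⊃L (pB _ (xs⊆x∷xs Γ'' _))
            (⊩-under [ D ] e (⊆-trans (B⊃D∷Γ⊆Γ' ∘ there) Γ'⊆Γ'') (All.map (Refuted-mono Γ'⊆Γ'') rΘ)))

  -- The premise yields G rather than D, so res_G is needed: refuting D gives a
  -- refutation of B ⊃ D, which the assumed refutation of B ⊃ D turns into G.
  ⊩-⊃R : B ∷ Γ ⊩ D ∷ Δ → Γ ⊩ (B ⊃' D) ∷ Δ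
  ⊩-⊃R {B} {D = D} d Γ' Γ⊆Γ' (r ∷ rs) = refute r (Persistent-⊃ pD)
    where
    pD : Persistent (B ∷ Γ') D
    pD Γ'' B∷Γ'⊆Γ'' =
      resG D (d Γ'' (⊆-trans (∷⁺ʳ B Γ⊆Γ') B∷Γ'⊆Γ'')
        ( Refuted-contra (λ _ → Persistent-⊃ ∘ Persistent-mono (xs⊆x∷xs _ B)) (Refuted-mono Γ'⊆Γ'' r)
        ∷ All.map (Refuted-mono Γ'⊆Γ'') rs))
      where
      Γ'⊆Γ'' : Γ' ⊆ Γ''
      Γ'⊆Γ'' = B∷Γ'⊆Γ'' ∘ there

  ⊩-∀L : ∀ {B} t → inst B t ∷ all B ∷ Γ ⊩ Δ → all B ∷ Γ ⊩ Δ
  ⊩-∀L {B = B} t d Γ' ∀B∷Γ⊆Γ' rs =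
    IG-absorb (∀B∷Γ⊆Γ' (here refl)) (∀L t (⊩-under (inst B t ∷ [ all B ]) d (∀B∷Γ⊆Γ' ∘ there) rs))

  ⊩-∃R : ∀ {B} t → Γ ⊩ inst B t ∷ Δ → Γ ⊩ ex B ∷ Δ
  ⊩-∃R t d Γ' Γ⊆Γ' (r ∷ rs) = d Γ' Γ⊆Γ' (Refuted-contra (λ _ → Persistent-map (∃R t)) r ∷ rs)

  ⊩-∃L : ∀ {B} → (∀ c → inst B (con c) ∷ Γ ⊩ Δ) → ex B ∷ Γ ⊩ Δ
  ⊩-∃L {B = B} d Γ' ∃B∷Γ⊆Γ' rs
    with c , c∉ ← fresh (constsL (ex B ∷ Γ') ++ constsF G ++ constsF G) =
    IG-absorb (∃B∷Γ⊆Γ' (here refl)) (∃L c c∉ (⊩-under [ inst B (con c) ] (d c) (∃B∷Γ⊆Γ' ∘ there) rs))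

  ⊩ʳ-∃L : ∀ {B} c → c ∉ constsL (ex B ∷ Γ) ++ constsL Δ →
          inst B (con c) ∷ Γ ⊩ʳ Δ → ex B ∷ Γ ⊩ʳ Δ
  ⊩ʳ-∃L {Γ} {Δ} {B} c c∉ d ρ = ⊩-∃L λ c' →
    subst₂ _⊩_
      (cong₂ _∷_ (mapConF-≔-inst ρ c' B (c∉ ∘ ∈-++⁺ˡ ∘ ∈-++⁺ˡ))
                 (map-mapConF-≔-fresh ρ c' Γ (c∉ ∘ ∈-++⁺ˡ ∘ ∈-++⁺ʳ (constsF B))))
      (map-mapConF-≔-fresh ρ c' Δ (c∉ ∘ ∈-++⁺ʳ (constsL (ex B ∷ Γ))))
      (d (ρ [ c ≔ c' ]))

  ⟹⇒⊩ʳ : Γ ⟹ Δ → All IsD Γ → All IsG Δ → Γ ⊩ʳ Δ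
  ⟹⇒⊩ʳ (ax⊤ ⊤∈Δ) _ _ ρ = ⊩-ax⊤ (∈-map⁺ (mapConF ρ) ⊤∈Δ)
  ⟹⇒⊩ʳ (ax a A∈Γ A∈Δ) _ _ ρ =
    ⊩-ax (mapConF-AtomOr⊥ ρ a) (∈-map⁺ (mapConF ρ) A∈Γ) (∈-map⁺ (mapConF ρ) A∈Δ)
  ⟹⇒⊩ʳ (exch p q d) Γᴰ Δᴳ ρ =
    ⊩-exch (↭-map⁺ (mapConF ρ) p) (↭-map⁺ (mapConF ρ) q)
      (⟹⇒⊩ʳ d (All-resp-↭ (↭-sym p) Γᴰ) (All-resp-↭ (↭-sym q) Δᴳ) ρ)
  ⟹⇒⊩ʳ (cL d) (a ∷ Γᴰ) Δᴳ ρ = ⊩-cL (⟹⇒⊩ʳ d (a ∷ a ∷ Γᴰ) Δᴳ ρ)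
  ⟹⇒⊩ʳ (cR d) Γᴰ (g ∷ Δᴳ) ρ = ⊩-cR (⟹⇒⊩ʳ d Γᴰ (g ∷ g ∷ Δᴳ) ρ)
  ⟹⇒⊩ʳ (⊥R _ d) Γᴰ (_ ∷ Δᴳ) ρ = ⊩-⊥R (⟹⇒⊩ʳ d Γᴰ (g⊥ ∷ Δᴳ) ρ)
  ⟹⇒⊩ʳ (∧L d) (d∧ a b ∷ Γᴰ) Δᴳ ρ = ⊩-∧L (⟹⇒⊩ʳ d (a ∷ b ∷ d∧ a b ∷ Γᴰ) Δᴳ ρ)
  ⟹⇒⊩ʳ (∧R d e) Γᴰ (g∧ a b ∷ Δᴳ) ρ = ⊩-∧R (⟹⇒⊩ʳ d Γᴰ (a ∷ Δᴳ) ρ) (⟹⇒⊩ʳ e Γᴰ (b ∷ Δᴳ) ρ)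
  ⟹⇒⊩ʳ (∨L d e) (d∨ a b ∷ Γᴰ) Δᴳ ρ = ⊩-∨L (⟹⇒⊩ʳ d (a ∷ Γᴰ) Δᴳ ρ) (⟹⇒⊩ʳ e (b ∷ Γᴰ) Δᴳ ρ)
  ⟹⇒⊩ʳ (∨R₁ _ d) Γᴰ (g∨ a _ ∷ Δᴳ) ρ = ⊩-∨R₁ (⟹⇒⊩ʳ d Γᴰ (a ∷ Δᴳ) ρ)
  ⟹⇒⊩ʳ (∨R₂ _ d) Γᴰ (g∨ _ b ∷ Δᴳ) ρ = ⊩-∨R₂ (⟹⇒⊩ʳ d Γᴰ (b ∷ Δᴳ) ρ)
  ⟹⇒⊩ʳ (⊃L {Δ = Δ} {Θ} d e) (d⊃ a b ∷ Γᴰ) ΔΘᴳ ρ =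
    subst (_ ⊩_) (sym (map-++ (mapConF ρ) Δ Θ))
      (⊩-⊃L (⟹⇒⊩ʳ d (d⊃ a b ∷ Γᴰ) (a ∷ ++⁻ˡ Δ ΔΘᴳ) ρ) (⟹⇒⊩ʳ e (b ∷ Γᴰ) (++⁻ʳ Δ ΔΘᴳ) ρ))
  ⟹⇒⊩ʳ (⊃R d) Γᴰ (g⊃ a b ∷ Δᴳ) ρ = ⊩-⊃R (⟹⇒⊩ʳ d (a ∷ Γᴰ) (b ∷ Δᴳ) ρ)
  ⟹⇒⊩ʳ (∀L {B = B} t d) (d∀ a ∷ Γᴰ) Δᴳ ρ =
    ⊩-∀L (mapConT ρ t) (subst (λ A → A ∷ _ ⊩ _) (mapConF-inst ρ B t)
      (⟹⇒⊩ʳ d (IsD-subF (sub0 t) a ∷ d∀ a ∷ Γᴰ) Δᴳ ρ))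
  ⟹⇒⊩ʳ (∃R {B = B} t d) Γᴰ (g∃ a ∷ Δᴳ) ρ =
    ⊩-∃R (mapConT ρ t) (subst (λ A → _ ⊩ A ∷ _) (mapConF-inst ρ B t)
      (⟹⇒⊩ʳ d Γᴰ (IsG-subF (sub0 t) a ∷ Δᴳ) ρ))
  ⟹⇒⊩ʳ (∃L c c∉ d) (d∃ a ∷ Γᴰ) Δᴳ = ⊩ʳ-∃L c c∉ (⟹⇒⊩ʳ d (IsD-subF (sub0 (con c)) a ∷ Γᴰ) Δᴳ)
  ⟹⇒⊩ʳ (∀R _ _ _) _ (() ∷ _)

  ⊩⇒IG : Γ ⊩ [ G ] → IG G Γ G
  ⊩⇒IG d = d _ ⊆-refl (Refuted-goal ∷ [])

theorem2 : (Γ : List Fm) (G : Fm) → All IsD Γ → IsG G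
             → (Γ ⟹ [ G ]) ⇔ IG G Γ G
theorem2 Γ G Γᴰ Gᴳ = mk⇔ C⇒IG (λ d → cR (IG⇒⟹ d 0))
  where
  C⇒IG : Γ ⟹ [ G ] → IG G Γ G
  C⇒IG d = ⊩⇒IG G (subst₂ (_⊩_ G) (map-mapConF-id Γ) (cong [_] (mapConF-id G))
                      (⟹⇒⊩ʳ G d Γᴰ (Gᴳ ∷ []) id))
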